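{- Let $\mathbf{T}=\langle T,\wedge,\vee,\to,\sim,0,1\rangle$ be a centered prelinear Nelson algebra with center $c$, and let $C(T)=\{x\in T: x\geq c\}$. Then $\mathbf{T}_C=\langle C(T),\wedge,\vee,\to,c,1\rangle$ (operations restricted from $T$) is a Gödel algebra, i.e. a Heyting algebra with bottom $c$ and top $1$ satisfying $(x\to y)\vee(y\to x)=1$. Moreover, if $f:\mathbf{T}\to\mathbf{S}$ is a homomorphism of centered Nelson algebras, then $C(f):C(T)\to C(S)$, $C(f)(x)=f(x)$, is a homomorphism of Gödel algebras.
   Context: A De Morgan algebra is a bounded distributive lattice with a unary $\sim$ satisfying $\sim\sim x=x$ and $\sim(x\vee y)=\sim x\wedge\sim y$; a Kleene algebra is a De Morgan algebra with $x\wedge\sim x\leq y\vee\sim y$. A Nelson algebra is $\langle T,\vee,\wedge,\to,\sim,0,1\rangle$ with Kleene reduct satisfying $x\to x=1$, $x\to(y\to z)=(x\wedge y)\to z$, $x\wedge(x\to y)=x\wedge(\sim x\vee y)$. It is prelinear if $(x\to y)\vee(y\to x)=1$, and centered if there is (a necessarily unique) $c\in T$ with $\sim c=c$, called the center. A Heyting algebra is an algebra $\langle A,\vee,\wedge,\Rightarrow,0,1\rangle$ with bounded lattice reduct satisfying $x\wedge(x\Rightarrow y)=x\wedge y$, $x\wedge(y\Rightarrow z)=x\wedge((x\wedge y)\Rightarrow(x\wedge z))$, $(x\wedge y)\Rightarrow x=1$; a Gödel algebra is a Heyting algebra satisfying $(x\Rightarrow y)\vee(y\Rightarrow x)=1$.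 Homomorphisms are the usual algebra homomorphisms. -}

module Defs where

open import Level using (0ℓ)
open import Data.Product using (Σ; _,_; proj₁; proj₂)
open import Relation.Binary.PropositionalEquality using (_≡_)
open import Algebra.Lattice.Structures using (IsLattice; IsDistributiveLattice)

record NelsonAlgebra : Set₁ where
  infixr 6 _∨_
  infixr 7 _∧_
  infixr 5 _⟶_
  field
    Carrier : Set
    _∨_ _∧_ _⟶_ : Carrier → Carrier → Carrier
    ∼_ : Carrier → Carrier
    𝟘 𝟙 : Carrier
    isDistributiveLattice : IsDistributiveLattice _≡_ _∨_ _∧_
    ∨-identity : ∀ x → x ∨ 𝟘 ≡ x
    ∧-identity : ∀ x → x ∧ 𝟙 ≡ x
    ∼-involutive : ∀ x → ∼ (∼ x) ≡ x
    ∼-deMorgan   : ∀ x y → ∼ (x ∨ y) ≡ (∼ x) ∧ (∼ y)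
    -- Kleene algebra:  x ∧ ∼x ≤ y ∨ ∼y  (≤ is the lattice order)
    kleene : ∀ x y → (x ∧ ∼ x) ∧ (y ∨ ∼ y) ≡ x ∧ ∼ x
    ⟶-refl  : ∀ x → x ⟶ x ≡ 𝟙
    ⟶-curry : ∀ x y z → x ⟶ (y ⟶ z) ≡ (x ∧ y) ⟶ z
    ⟶-mp    : ∀ x y → x ∧ (x ⟶ y) ≡ x ∧ (∼ x ∨ y)

  _≤_ : Carrier → Carrier → Set
  x ≤ y = x ∧ y ≡ x

module _ (T : NelsonAlgebra) where
  open NelsonAlgebra T

  Prelinear : Set
  Prelinear = ∀ x y → (x ⟶ y) ∨ (y ⟶ x) ≡ 𝟙

  IsCenter : Carrier → Set
  IsCenter c = ∼ c ≡ c

  C : Carrier → Set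
  C c = Σ Carrier (λ x → c ≤ x)

  record ClosedC (c : Carrier) : Set where
    field
      ∧-closed : ∀ {x y} → c ≤ x → c ≤ y → c ≤ (x ∧ y)
      ∨-closed : ∀ {x y} → c ≤ x → c ≤ y → c ≤ (x ∨ y)
      ⟶-closed : ∀ {x y} → c ≤ x → c ≤ y → c ≤ (x ⟶ y)
      c-in     : c ≤ c
      𝟙-in     : c ≤ 𝟙

record HSig : Set₁ where
  field
    Carrier : Set
    _≈_ : Carrier → Carrier → Set
    _∨_ _∧_ _⇒_ : Carrier → Carrier → Carrier
    𝟘 𝟙 : Carrier

record IsHeytingAlgebra (H : HSig) : Set where
  open HSig H
  field
    isLattice  : IsLattice _≈_ _∨_ _∧_
    ⇒-cong     : ∀ {x x' y y'} → x ≈ x' → y ≈ y' → (x ⇒ y) ≈ (x' ⇒ y')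
    ∨-identity : ∀ x → (x ∨ 𝟘) ≈ x
    ∧-identity : ∀ x → (x ∧ 𝟙) ≈ x
    h1 : ∀ x y → (x ∧ (x ⇒ y)) ≈ (x ∧ y)
    h2 : ∀ x y z → (x ∧ (y ⇒ z)) ≈ (x ∧ ((x ∧ y) ⇒ (x ∧ z)))
    h3 : ∀ x y → ((x ∧ y) ⇒ x) ≈ 𝟙

record IsGodelAlgebra (H : HSig) : Set where
  open HSig H
  field
    isHeytingAlgebra : IsHeytingAlgebra H
    prelinear : ∀ x y → ((x ⇒ y) ∨ (y ⇒ x)) ≈ 𝟙

record IsHomomorphism (H K : HSig) (f : HSig.Carrier H → HSig.Carrier K) : Set where
  module H = HSig H
  module K = HSig K
  field
    ∨-hom : ∀ x y → f (x H.∨ y) K.≈ (f x K.∨ f y)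
    ∧-hom : ∀ x y → f (x H.∧ y) K.≈ (f x K.∧ f y)
    ⇒-hom : ∀ x y → f (x H.⇒ y) K.≈ (f x K.⇒ f y)
    𝟘-hom : f H.𝟘 K.≈ K.𝟘
    𝟙-hom : f H.𝟙 K.≈ K.𝟙

TC : (T : NelsonAlgebra) (c : NelsonAlgebra.Carrier T) → ClosedC T c → HSig
TC T c cl = record
  { Carrier = C T c
  ; _≈_ = λ a b → proj₁ a ≡ proj₁ b
  ; _∨_ = λ a b → (proj₁ a ∨ proj₁ b) , ∨-closed (proj₂ a) (proj₂ b)
  ; _∧_ = λ a b → (proj₁ a ∧ proj₁ b) , ∧-closed (proj₂ a) (proj₂ b)
  ; _⇒_ = λ a b → (proj₁ a ⟶ proj₁ b) , ⟶-closed (proj₂ a) (proj₂ b)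
  ; 𝟘 = c , c-in
  ; 𝟙 = 𝟙 , 𝟙-in
  }
  where open NelsonAlgebra T
        open ClosedC cl

record NelsonHom (T S : NelsonAlgebra) : Set where
  module T = NelsonAlgebra T
  module S = NelsonAlgebra S
  field
    fun : T.Carrier → S.Carrier
    ∨-hom : ∀ x y → fun (x T.∨ y) ≡ fun x S.∨ fun y
    ∧-hom : ∀ x y → fun (x T.∧ y) ≡ fun x S.∧ fun y
    ⟶-hom : ∀ x y → fun (x T.⟶ y) ≡ fun x S.⟶ fun y
    ∼-hom : ∀ x → fun (T.∼ x) ≡ S.∼ (fun x)
    𝟘-hom : fun T.𝟘 ≡ S.𝟘
    𝟙-hom : fun T.𝟙 ≡ S.𝟙

-- If c ≤ x and c ≤ y then ∼ x ≤ ∼ c = c ≤ y, so on C(T) the Nelson law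
-- x ∧ (x ⟶ y) = x ∧ (∼ x ∨ y) becomes modus ponens x ∧ (x ⟶ y) = x ∧ y. Together with
-- currying this makes ⟶ the residual of ∧ on C(T), so C(T) is a Heyting algebra with
-- bottom c, and prelinearity is inherited from T. A homomorphism f preserves ∼, so f c is a
-- center of S, hence equal to d: the Kleene inequality forces any two centers a, b to satisfy
-- a = a ∧ ∼ a ≤ b ∨ ∼ b = b. Monotonicity of f then maps C(T) into C(S).
module Submission where

open import Defs
open import Level using (0ℓ)
open import Data.Product using (Σ-syntax; _×_; _,_; proj₁; proj₂)
open import Function using (_on_)
open import Relation.Binary.PropositionalEquality as ≡ using (_≡_; refl; cong; cong₂; subst)
import Relation.Binary.Construct.On as On
open import Relation.Binary.Lattice using (IsLattice; Lattice; HeytingAlgebra)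
import Relation.Binary.Lattice.Properties.Lattice as LatticeProperties
import Relation.Binary.Lattice.Properties.HeytingAlgebra as HeytingAlgebraProperties
import Relation.Binary.Lattice.Properties.BoundedJoinSemilattice as BoundedJoinSemilatticeProperties
import Relation.Binary.Lattice.Properties.BoundedMeetSemilattice as BoundedMeetSemilatticeProperties
import Relation.Binary.Lattice.Properties.JoinSemilattice as JoinSemilatticeProperties
import Relation.Binary.Lattice.Properties.MeetSemilattice as MeetSemilatticeProperties
import Relation.Binary.Reasoning.Setoid as SetoidReasoning
open import Algebra.Lattice.Structures using (IsDistributiveLattice)
import Algebra.Lattice.Bundles as Alg
import Algebra.Lattice.Properties.Lattice as AlgLatticeProperties

module HeytingAlgebraLaws {c ℓ₁ ℓ₂} (H : HeytingAlgebra c ℓ₁ ℓ₂) where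
  open HeytingAlgebra H
  open HeytingAlgebraProperties H using (⇨-app; ⇨-curry; ⇨-distribˡ-∧)
  open MeetSemilatticeProperties meetSemilattice using (∧-comm; ∧-cong)
  open BoundedMeetSemilatticeProperties boundedMeetSemilattice using (identityˡ)
  open SetoidReasoning setoid

  x∧[x⇨y]≈x∧y : ∀ x y → x ∧ (x ⇨ y) ≈ x ∧ y
  x∧[x⇨y]≈x∧y x y = begin
    x ∧ (x ⇨ y) ≈⟨ ∧-comm x (x ⇨ y) ⟩
    (x ⇨ y) ∧ x ≈⟨ ⇨-app ⟩
    y ∧ x       ≈⟨ ∧-comm y x ⟩
    x ∧ y       ∎

  x≤y⇒x⇨y≈⊤ : ∀ {x y} → x ≤ y → x ⇨ y ≈ ⊤
  x≤y⇒x⇨y≈⊤ x≤y = antisym (maximum _) (transpose-⇨ (trans (x∧y≤y _ _) x≤y))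

  x∧[y⇨z]≈x∧[x∧y⇨x∧z] : ∀ x y z → x ∧ (y ⇨ z) ≈ x ∧ (x ∧ y ⇨ x ∧ z)
  x∧[y⇨z]≈x∧[x∧y⇨x∧z] x y z = begin
    x ∧ (y ⇨ z)                      ≈⟨ x∧[x⇨y]≈x∧y x (y ⇨ z) ⟨
    x ∧ (x ⇨ y ⇨ z)                  ≈⟨ ∧-congˡ ⇨-curry ⟨
    x ∧ (x ∧ y ⇨ z)                  ≈⟨ ∧-congˡ (identityˡ _) ⟨
    x ∧ (⊤ ∧ (x ∧ y ⇨ z))            ≈⟨ ∧-congˡ (∧-cong (x≤y⇒x⇨y≈⊤ (x∧y≤x x y)) Eq.refl) ⟨
    x ∧ ((x ∧ y ⇨ x) ∧ (x ∧ y ⇨ z)) ≈⟨ ∧-congˡ (⇨-distribˡ-∧ (x ∧ y) x z) ⟨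
    x ∧ (x ∧ y ⇨ x ∧ z)              ∎
    where ∧-congˡ : ∀ {u v} → u ≈ v → x ∧ u ≈ x ∧ v
          ∧-congˡ = ∧-cong Eq.refl

module _ {ℓ} (H : HeytingAlgebra 0ℓ 0ℓ ℓ) where
  open HeytingAlgebra H
  open HeytingAlgebraLaws H

  heytingSignature : HSig
  heytingSignature = record
    { Carrier = Carrier ; _≈_ = _≈_ ; _∨_ = _∨_ ; _∧_ = _∧_ ; _⇒_ = _⇨_ ; 𝟘 = ⊥ ; 𝟙 = ⊤ }

  heytingAlgebra-isHeytingAlgebra : IsHeytingAlgebra heytingSignature
  heytingAlgebra-isHeytingAlgebra = record
    { isLattice  = LatticeProperties.isAlgLattice lattice
    ; ⇒-cong     = HeytingAlgebraProperties.⇨-cong H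
    ; ∨-identity = BoundedJoinSemilatticeProperties.identityʳ boundedJoinSemilattice
    ; ∧-identity = BoundedMeetSemilatticeProperties.identityʳ boundedMeetSemilattice
    ; h1 = x∧[x⇨y]≈x∧y
    ; h2 = x∧[y⇨z]≈x∧[x∧y⇨x∧z]
    ; h3 = λ x y → x≤y⇒x⇨y≈⊤ (x∧y≤x x y)
    }

module NelsonAlgebraLaws (T : NelsonAlgebra) where
  open NelsonAlgebra T
  open IsDistributiveLattice isDistributiveLattice using (isLattice; ∨-comm; ∧-comm)
  open ≡.≡-Reasoning

  private
    algLattice : Alg.Lattice 0ℓ 0ℓ
    algLattice = record { isLattice = isLattice }

  open AlgLatticeProperties algLattice using (∧-idem; ∨-idem; ∨-∧-isOrderTheoreticLattice)

  -- _≤_ is the library's natural order x ≡ x ∧ y with the equation read backwards.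
  ≤-isLattice : IsLattice _≡_ _≤_ _∨_ _∧_
  ≤-isLattice = record
    { isPartialOrder = record
      { isPreorder = record
        { isEquivalence = ≡.isEquivalence
        ; reflexive     = λ { refl → ∧-idem _ }
        ; trans         = λ x≤y y≤z → ≡.sym (N.trans (≡.sym x≤y) (≡.sym y≤z))
        }
      ; antisym = λ x≤y y≤x → N.antisym (≡.sym x≤y) (≡.sym y≤x)
      }
    ; supremum = λ x y → let x≤x∨y , y≤x∨y , least = N.supremum x y
                         in ≡.sym x≤x∨y , ≡.sym y≤x∨y , λ z x≤z y≤z → ≡.sym (least z (≡.sym x≤z) (≡.sym y≤z))
    ; infimum  = λ x y → let x∧y≤x , x∧y≤y , greatest = N.infimum x y
                         in ≡.sym x∧y≤x , ≡.sym x∧y≤y , λ z z≤x z≤y → ≡.sym (greatest z (≡.sym z≤x) (≡.sym z≤y))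
    }
    where module N = IsLattice ∨-∧-isOrderTheoreticLattice

  ≤-lattice : Lattice 0ℓ 0ℓ 0ℓ
  ≤-lattice = record { isLattice = ≤-isLattice }

  open IsLattice ≤-isLattice
    using (isPartialOrder; supremum; infimum; x≤x∨y; x∧y≤y; ∧-greatest; antisym)
    renaming (refl to ≤-refl; trans to ≤-trans)
  open MeetSemilatticeProperties (Lattice.meetSemilattice ≤-lattice) using (∧-monotonic)
  open JoinSemilatticeProperties (Lattice.joinSemilattice ≤-lattice) using (x≤y⇒x∨y≈y)

  ∼-antitone : ∀ {x y} → x ≤ y → (∼ y) ≤ (∼ x)
  ∼-antitone {x} {y} x≤y = begin
    ∼ y ∧ ∼ x ≡⟨ ∼-deMorgan y x ⟨
    ∼ (y ∨ x) ≡⟨ cong ∼_ (≡.trans (∨-comm y x) (x≤y⇒x∨y≈y x≤y)) ⟩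
    ∼ y       ∎

  x⟶𝟙≡𝟙 : ∀ x → x ⟶ 𝟙 ≡ 𝟙
  x⟶𝟙≡𝟙 x = begin
    x ⟶ 𝟙       ≡⟨ cong (x ⟶_) (⟶-refl x) ⟨
    x ⟶ (x ⟶ x) ≡⟨ ⟶-curry x x x ⟩
    (x ∧ x) ⟶ x ≡⟨ cong (_⟶ x) (∧-idem x) ⟩
    x ⟶ x       ≡⟨ ⟶-refl x ⟩
    𝟙           ∎

  x≤y⇒x⟶y≡𝟙 : ∀ {x y} → x ≤ y → x ⟶ y ≡ 𝟙
  x≤y⇒x⟶y≡𝟙 {x} {y} x≤y = begin
    x ⟶ y       ≡⟨ cong (_⟶ y) x≤y ⟨
    (x ∧ y) ⟶ y ≡⟨ ⟶-curry x y y ⟨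
    x ⟶ (y ⟶ y) ≡⟨ cong (x ⟶_) (⟶-refl y) ⟩
    x ⟶ 𝟙       ≡⟨ x⟶𝟙≡𝟙 x ⟩
    𝟙           ∎

  center-unique : ∀ {a b} → IsCenter T a → IsCenter T b → a ≡ b
  center-unique ∼a≡a ∼b≡b = antisym (center≤center ∼a≡a ∼b≡b) (center≤center ∼b≡b ∼a≡a)
    where
    center≤center : ∀ {a b} → IsCenter T a → IsCenter T b → a ≤ b
    center≤center {a} {b} ∼a≡a ∼b≡b = begin
      a ∧ b                 ≡⟨ cong₂ _∧_ a∧∼a≡a b∨∼b≡b ⟨
      (a ∧ ∼ a) ∧ (b ∨ ∼ b) ≡⟨ kleene a b ⟩
      a ∧ ∼ a               ≡⟨ a∧∼a≡a ⟩
      a                     ∎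
      where
      a∧∼a≡a : a ∧ ∼ a ≡ a
      a∧∼a≡a = ≡.trans (cong (a ∧_) ∼a≡a) (∧-idem a)
      b∨∼b≡b : b ∨ ∼ b ≡ b
      b∨∼b≡b = ≡.trans (cong (b ∨_) ∼b≡b) (∨-idem b)

  module Centered {c : Carrier} (∼c≡c : IsCenter T c) where

    ∼x∨y≡y : ∀ {x y} → c ≤ x → c ≤ y → ∼ x ∨ y ≡ y
    ∼x∨y≡y {x} c≤x c≤y = x≤y⇒x∨y≈y (≤-trans (subst ((∼ x) ≤_) ∼c≡c (∼-antitone c≤x)) c≤y)

    x∧[x⟶y]≡x∧y : ∀ {x y} → c ≤ x → c ≤ y → x ∧ (x ⟶ y) ≡ x ∧ y
    x∧[x⟶y]≡x∧y {x} {y} c≤x c≤y = ≡.trans (⟶-mp x y) (cong (x ∧_) (∼x∨y≡y c≤x c≤y))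

    c≤x⟶y : ∀ {x y} → c ≤ x → c ≤ y → c ≤ (x ⟶ y)
    c≤x⟶y {x} {y} c≤x c≤y =
      ≤-trans (subst (c ≤_) (≡.sym (x∧[x⟶y]≡x∧y c≤x c≤y)) (∧-greatest c≤x c≤y)) (x∧y≤y x (x ⟶ y))

    transpose-⟶ : ∀ {w x y} → c ≤ w → c ≤ x → c ≤ y → (w ∧ x) ≤ y → w ≤ (x ⟶ y)
    transpose-⟶ {w} {x} {y} c≤w c≤x c≤y w∧x≤y = begin
      w ∧ (x ⟶ y)       ≡⟨ x∧[x⟶y]≡x∧y c≤w (c≤x⟶y c≤x c≤y) ⟨
      w ∧ (w ⟶ (x ⟶ y)) ≡⟨ cong (w ∧_) (⟶-curry w x y) ⟩
      w ∧ ((w ∧ x) ⟶ y) ≡⟨ cong (w ∧_) (x≤y⇒x⟶y≡𝟙 w∧x≤y) ⟩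
      w ∧ 𝟙             ≡⟨ ∧-identity w ⟩
      w                 ∎

    transpose-∧ : ∀ {w x y} → c ≤ x → c ≤ y → w ≤ (x ⟶ y) → (w ∧ x) ≤ y
    transpose-∧ {w} {x} {y} c≤x c≤y w≤x⟶y =
      ≤-trans (∧-monotonic w≤x⟶y ≤-refl) (subst (_≤ y) (≡.sym [x⟶y]∧x≡x∧y) (x∧y≤y x y))
      where
      [x⟶y]∧x≡x∧y : (x ⟶ y) ∧ x ≡ x ∧ y
      [x⟶y]∧x≡x∧y = ≡.trans (∧-comm (x ⟶ y) x) (x∧[x⟶y]≡x∧y c≤x c≤y)

    closedC : ClosedC T c
    closedC = record
      { ∧-closed = ∧-greatest
      ; ∨-closed = λ {x} {y} c≤x _ → ≤-trans c≤x (x≤x∨y x y)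
      ; ⟶-closed = c≤x⟶y
      ; c-in     = ≤-refl
      ; 𝟙-in     = ∧-identity c
      }

    private
      module C = HSig (TC T c closedC)

    C-heytingAlgebra : HeytingAlgebra 0ℓ 0ℓ 0ℓ
    C-heytingAlgebra = record
      { Carrier = C.Carrier
      ; _≈_ = C._≈_
      ; _≤_ = _≤_ on proj₁
      ; _∨_ = C._∨_
      ; _∧_ = C._∧_
      ; _⇨_ = C._⇒_
      ; ⊤   = C.𝟙
      ; ⊥   = C.𝟘
      ; isHeytingAlgebra = record
        { isBoundedLattice = record
          { isLattice = record
            { isPartialOrder = On.isPartialOrder proj₁ isPartialOrder
            ; supremum = λ a b → let x≤x∨y , y≤x∨y , least = supremum (proj₁ a) (proj₁ b)
                                 in x≤x∨y , y≤x∨y , λ z → least (proj₁ z)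
            ; infimum  = λ a b → let x∧y≤x , x∧y≤y , greatest = infimum (proj₁ a) (proj₁ b)
                                 in x∧y≤x , x∧y≤y , λ z → greatest (proj₁ z)
            }
          ; maximum = λ a → ∧-identity (proj₁ a)
          ; minimum = proj₂
          }
        ; exponential = λ w x y → transpose-⟶ (proj₂ w) (proj₂ x) (proj₂ y) , transpose-∧ (proj₂ x) (proj₂ y)
        }
      }

    C-isGodelAlgebra : Prelinear T → IsGodelAlgebra (TC T c closedC)
    C-isGodelAlgebra prelinear = record
      { isHeytingAlgebra = heytingAlgebra-isHeytingAlgebra C-heytingAlgebra
      ; prelinear        = λ a b → prelinear (proj₁ a) (proj₁ b)
      }

module NelsonHomLaws {T S : NelsonAlgebra} (f : NelsonHom T S) where
  open NelsonHom f

  fun-monotone : ∀ {x y} → x T.≤ y → fun x S.≤ fun y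
  fun-monotone {x} {y} x≤y = ≡.trans (≡.sym (∧-hom x y)) (cong fun x≤y)

  fun-center : ∀ {c} → IsCenter T c → IsCenter S (fun c)
  fun-center {c} ∼c≡c = ≡.trans (≡.sym (∼-hom c)) (cong fun ∼c≡c)

  module _ {c d} (∼c≡c : IsCenter T c) (∼d≡d : IsCenter S d) where

    fun-center≡center : fun c ≡ d
    fun-center≡center = NelsonAlgebraLaws.center-unique S (fun-center ∼c≡c) ∼d≡d

    fun-above : ∀ {x} → c T.≤ x → d S.≤ fun x
    fun-above c≤x = subst (S._≤ fun _) fun-center≡center (fun-monotone c≤x)

    C-isHomomorphism : (clT : ClosedC T c) (clS : ClosedC S d) →
      IsHomomorphism (TC T c clT) (TC S d clS) (λ a → fun (proj₁ a) , fun-above (proj₂ a))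
    C-isHomomorphism _ _ = record
      { ∨-hom = λ a b → ∨-hom (proj₁ a) (proj₁ b)
      ; ∧-hom = λ a b → ∧-hom (proj₁ a) (proj₁ b)
      ; ⇒-hom = λ a b → ⟶-hom (proj₁ a) (proj₁ b)
      ; 𝟘-hom = fun-center≡center
      ; 𝟙-hom = 𝟙-hom
      }

lemma6 : (T : NelsonAlgebra) (c : NelsonAlgebra.Carrier T) → IsCenter T c → Prelinear T →
    Σ[ cl ∈ ClosedC T c ] IsGodelAlgebra (TC T c cl)
    × ((S : NelsonAlgebra) (d : NelsonAlgebra.Carrier S) → IsCenter S d →
       (f : NelsonHom T S) →
       (clT : ClosedC T c) (clS : ClosedC S d) →
       Σ[ m ∈ (∀ {x} → NelsonAlgebra._≤_ T c x → NelsonAlgebra._≤_ S d (NelsonHom.fun f x)) ]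
         IsHomomorphism (TC T c clT) (TC S d clS) (λ a → NelsonHom.fun f (proj₁ a) , m (proj₂ a)))
lemma6 T c ∼c≡c prelinear =
  closedC , C-isGodelAlgebra prelinear ,
  λ S d ∼d≡d f clT clS → let open NelsonHomLaws f in
    fun-above ∼c≡c ∼d≡d , C-isHomomorphism ∼c≡c ∼d≡d clT clS
  where open NelsonAlgebraLaws.Centered T ∼c≡c
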